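{- Let $n\ge 0$ and let $\bar{\mathcal S}(2n+1)$ be the set of equivalence classes, under pivoting, of complete binary trees with $2n+1$ vertices. For $\bar s\in\bar{\mathcal S}(2n+1)$ put $T(\bar s)=\sum_{s\in\bar s}\#\mathcal L(s)$, $G(\bar s)=(n+1)T(\bar s)/2^{2n}$, and $H(\bar s)=\prod_{v\in s}h_v$ for any $s\in\bar s$. Then $$f(n):=\sum_{\bar s\in\bar{\mathcal S}(2n+1)}H(\bar s)G(\bar s)=\bigl(1\cdot 3\cdot 5\cdots(2n-1)\bigr)^2(2n+1)=(2n-1)!!\,(2n+1)!!.$$
   Context: A complete binary tree is a rooted binary tree (with ordered left/right subtrees) in which the two subtrees of each vertex are either both empty or both non-empty. The hook length $h_v$ of a vertex $v$ is the number of descendants of $v$ including $v$; the product $\prod_{v\in s}h_v$ is the same for all trees in an equivalence class. $\mathcal L(s)$ is the set of increasing labellings of $s$: bijective labellings of the vertices by $\{1,\dots,2n+1\}$ such that each vertex has a smaller label than all its descendants. A basic pivoting exchanges the two subtrees of a non-leaf vertex; two complete binary trees are equivalent under pivoting if one can be transformed into the other by a finite sequence of basic pivotings. For $n=0$, $(2n-1)!!=1$. -}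

module Defs where

open import Data.Nat as ℕ using (ℕ; zero; suc; _+_; _*_; _^_; _<_)
open import Data.Nat.Properties using (m^n≢0)
open import Data.Fin using (Fin)
open import Data.Fin as Fin using (toℕ)
open import Data.Integer using (+_)
open import Data.Rational as ℚ using (ℚ; 0ℚ)
open import Data.Product using (Σ; ∃; _×_; proj₁)
open import Data.List using (List; []; _∷_; filter)
open import Relation.Nullary using (Dec; ¬_)
open import Relation.Binary.PropositionalEquality using (_≡_; _≗_)
open import Relation.Binary.Construct.Closure.ReflexiveTransitive using (Star)
open import Function.Definitions using (Bijective)

data Tree : Set where
  leaf : Tree
  node : Tree → Tree → Tree

size : Tree → ℕ
size leaf = 1
size (node l r) = suc (size l + size r)

-- vertices of a tree, as paths from the root
data Pos : Tree → Set where
  here  : ∀ {t} → Pos t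
  left  : ∀ {l r} → Pos l → Pos (node l r)
  right : ∀ {l r} → Pos r → Pos (node l r)

data Desc : {t : Tree} → Pos t → Pos t → Set where
  root-l : ∀ {l r} {q : Pos l} → Desc {node l r} here (left q)
  root-r : ∀ {l r} {q : Pos r} → Desc {node l r} here (right q)
  in-l   : ∀ {l r} {p q : Pos l} → Desc p q → Desc {node l r} (left p) (left q)
  in-r   : ∀ {l r} {p q : Pos r} → Desc p q → Desc {node l r} (right p) (right q)

-- increasing labellings: bijections Pos s → {0,…,2n} (labels shifted by 1)
-- with every vertex labelled smaller than its strict descendants
IncLab : Tree → Set
IncLab s = Σ (Pos s → Fin (size s)) λ f →
  Bijective _≡_ _≡_ f × (∀ p q → Desc p q → toℕ (f p) < toℕ (f q))

-- HasCount s c : #L(s) = c, witnessed by an enumeration of L(s) by Fin c,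
-- exhaustive and injective up to pointwise equality of labellings
HasCount : Tree → ℕ → Set
HasCount s c = Σ (Fin c → IncLab s) λ e →
  (∀ (L : IncLab s) → ∃ λ i → proj₁ (e i) ≗ proj₁ L) ×
  (∀ i j → proj₁ (e i) ≗ proj₁ (e j) → i ≡ j)

hookProd : Tree → ℕ
hookProd leaf = 1
hookProd (node l r) = size (node l r) * hookProd l * hookProd r

data Pivot : Tree → Tree → Set where
  swap : ∀ {l r} → Pivot (node l r) (node r l)
  in-l : ∀ {l l' r} → Pivot l l' → Pivot (node l r) (node l' r)
  in-r : ∀ {l r r'} → Pivot r r' → Pivot (node l r) (node l r')

_~_ : Tree → Tree → Set
_~_ = Star Pivot

sumℕ : List ℕ → ℕ
sumℕ [] = 0
sumℕ (x ∷ xs) = x + sumℕ xs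

-- 1·3·5···(2n-1) = (2n-1)!!  (empty product = 1 for n = 0)
oddProd : ℕ → ℕ
oddProd zero = 1
oddProd (suc n) = oddProd n * (2 * n + 1)

Tcls : (Ts : List Tree) (cnt : Tree → ℕ) (dec : ∀ s t → Dec (s ~ t)) → Tree → ℕ
Tcls Ts cnt dec r = sumℕ (Data.List.map cnt (filter (λ s → dec s r) Ts))

Gval : ℕ → ℕ → ℚ
Gval n T = (+ ((n + 1) * T) ℚ./ (2 ^ (2 * n))) {{m^n≢0 2 (2 * n)}}

fval : (n : ℕ) (Ts : List Tree) (cnt : Tree → ℕ) (dec : ∀ s t → Dec (s ~ t)) → List Tree → ℚ
fval n Ts cnt dec [] = 0ℚ
fval n Ts cnt dec (r ∷ R) =
  ((+ hookProd r) ℚ./ 1) ℚ.* Gval n (Tcls Ts cnt dec r) ℚ.+ fval n Ts cnt dec R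

module Submission where

-- Write K = (2n+1)!.  Two classical facts drive the proof.
--  (1) Hook length formula: H(s) · #L(s) = |s|! = K for every tree s with
--      2n+1 vertices.  We prove it for forests by deleting the root that
--      carries the smallest label, which gives #L(F, N+1) = ∑_i #L(F - root_i, N).
--  (2) There are c_n trees with 2n+1 vertices (n internal ones), where the
--      Catalan numbers satisfy c_{k+1} = ∑_i c_i c_{k-i}; from this
--      convolution we derive (k+2) c_{k+1} = 2(2k+1) c_k and the closed form
--      (n+1) c_n K = 4ⁿ (2n-1)!! (2n+1)!!.
-- Since pivoting preserves H, every s in the class of a representative r
-- has H(r) #L(s) = K, and as the classes partition the trees,
-- ∑_r H(r) T(r) = K · c_n.  Hence f(n) = (n+1) K c_n / 4ⁿ = (2n-1)!! (2n+1)!!.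

open import Defs
open import Data.Nat using (ℕ; zero; suc; _+_; _*_; _∸_; _^_; _≤_; _<_; s≤s; z≤n; _!; NonZero)
import Data.Nat.Properties as ℕ
open import Data.Nat.Induction using (<-rec)
open import Data.Nat.Tactic.RingSolver using (solve-∀)
import Data.Integer as ℤ
open import Data.Integer.Properties using (pos-*)
import Data.Integer.Tactic.RingSolver as ℤ-Solver
open import Data.Rational as ℚ using (_/_; toℚᵘ)
open import Data.Rational.Unnormalised as ℚᵘ using (ℚᵘ; mkℚᵘ; *≡*; _≃_)
open import Data.Rational.Properties using (toℚᵘ-injective; toℚᵘ-homo-*; toℚᵘ-homo-+; toℚᵘ-fromℚᵘ; 0/n≡0)
import Data.Rational.Unnormalised.Properties as ℚᵘ
open import Data.Fin using (Fin; zero; suc; toℕ; fromℕ<; punchOut)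
open import Data.Fin.Properties
  using (injective⇒≤; +↔⊎; *↔×; suc-injective; 0≢1+n; punchIn-punchOut; toℕ<n; toℕ-fromℕ<; fromℕ<-cong; fromℕ<-toℕ)
open import Data.Product using (Σ; ∃; _×_; _,_; proj₁; proj₂)
open import Data.Product.Relation.Binary.Pointwise.NonDependent using (×-isEquivalence)
  renaming (Pointwise to ×-Pointwise)
open import Data.Sum using (_⊎_; inj₁; inj₂)
open import Data.Sum.Properties using (inj₁-injective; inj₂-injective)
open import Data.Sum.Relation.Binary.Pointwise using (inj₁; inj₂; ⊎-isEquivalence)
  renaming (Pointwise to ⊎-Pointwise)
open import Data.Empty using (⊥; ⊥-elim)
open import Data.List using (List; []; _∷_; map; filter; length; lookup)
open import Data.List.Membership.Propositional using (_∈_)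
open import Data.List.Membership.Propositional.Properties using (∈-lookup)
open import Data.List.Relation.Unary.Any using (here; there; index)
open import Data.List.Relation.Unary.Any.Properties using (lookup-index)
open import Data.List.Relation.Unary.All as All using (All; _∷_)
open import Data.List.Relation.Unary.AllPairs using (AllPairs; _∷_)
open import Data.List.Relation.Unary.Unique.Propositional using (Unique)
open import Relation.Nullary using (Dec; yes; no; ¬_)
open import Relation.Binary.Structures using (IsEquivalence)
open import Relation.Binary.PropositionalEquality
open import Relation.Binary.Construct.Closure.ReflexiveTransitive using (ε; _◅_; _◅◅_; reverse)
open import Function using (_∘_; _↔_; Inverse; Injective; Surjective; Bijective; _⇔_; Equivalence; mk⇔)
open import Algebra.Properties.Semiring.Sum ℕ.+-*-semiring
  using (sum; sum-cong-≗; *-distribˡ-sum; *-distribʳ-sum)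
open ≡-Reasoning

CountUpTo : (A : Set) → (A → A → Set) → ℕ → Set
CountUpTo A R c = Σ (Fin c → A) λ e →
  (∀ (a : A) → ∃ λ i → R (e i) a) × (∀ i j → R (e i) (e j) → i ≡ j)

-- The number of elements is well defined: each enumeration injects into any
-- other one, so by the pigeonhole principle their lengths agree.
count-unique : ∀ {A R c c'} → IsEquivalence R → CountUpTo A R c → CountUpTo A R c' → c ≡ c'
count-unique {A} {R} eqv C C' = ℕ.≤-antisym (count-≤ C C') (count-≤ C' C)
  where
  module R = IsEquivalence eqv
  count-≤ : ∀ {c c'} → CountUpTo A R c → CountUpTo A R c' → c ≤ c'
  count-≤ {c} {c'} (e , _ , distinct) (e' , exhaustive' , _) = injective⇒≤ φ-injective
    where
    φ : Fin c → Fin c'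
    φ i = proj₁ (exhaustive' (e i))
    φ-injective : ∀ {i j} → φ i ≡ φ j → i ≡ j
    φ-injective {i} {j} φi≡φj = distinct i j
      (R.trans (R.sym (proj₂ (exhaustive' (e i))))
        (subst (λ k → R (e' k) (e j)) (sym φi≡φj) (proj₂ (exhaustive' (e j)))))

count-via : ∀ {I A : Set} {R c} → Fin c ↔ I → (e : I → A) →
  (∀ a → ∃ λ i → R (e i) a) → (∀ i j → R (e i) (e j) → i ≡ j) → CountUpTo A R c
count-via {R = R} ι e exhaustive distinct =
  e ∘ to ,
  (λ a → from (proj₁ (exhaustive a)) ,
         subst (λ i → R (e i) a) (sym (strictlyInverseˡ _)) (proj₂ (exhaustive a))) ,
  λ k k' r → trans (sym (strictlyInverseʳ k))
               (trans (cong from (distinct _ _ r)) (strictlyInverseʳ k'))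
  where open Inverse ι

count-transport : ∀ {A B R S c} → IsEquivalence R → IsEquivalence S →
  (F : A → B) (G : B → A) →
  (∀ {a a'} → R a a' → S (F a) (F a')) → (∀ {b b'} → S b b' → R (G b) (G b')) →
  (∀ b → S (F (G b)) b) → (∀ a → R (G (F a)) a) →
  CountUpTo A R c → CountUpTo B S c
count-transport eqR eqS F G F-cong G-cong FG GF (e , exhaustive , distinct) =
  F ∘ e ,
  (λ b → proj₁ (exhaustive (G b)) , S.trans (F-cong (proj₂ (exhaustive (G b)))) (FG b)) ,
  λ i j s → distinct i j (R.trans (R.sym (GF (e i))) (R.trans (G-cong s) (GF (e j))))
  where
  module R = IsEquivalence eqR
  module S = IsEquivalence eqS

count-⊎ : ∀ {A B R S a b} → CountUpTo A R a → CountUpTo B S b →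
  CountUpTo (A ⊎ B) (⊎-Pointwise R S) (a + b)
count-⊎ {A} {B} {R} {S} (eA , exhaustiveA , distinctA) (eB , exhaustiveB , distinctB) =
  count-via {R = ⊎-Pointwise R S} +↔⊎ e exhaustive distinct
  where
  e : _ → A ⊎ B
  e (inj₁ i) = inj₁ (eA i)
  e (inj₂ j) = inj₂ (eB j)
  exhaustive : ∀ x → ∃ λ i → ⊎-Pointwise R S (e i) x
  exhaustive (inj₁ x) = inj₁ (proj₁ (exhaustiveA x)) , inj₁ (proj₂ (exhaustiveA x))
  exhaustive (inj₂ y) = inj₂ (proj₁ (exhaustiveB y)) , inj₂ (proj₂ (exhaustiveB y))
  distinct : ∀ i j → ⊎-Pointwise R S (e i) (e j) → i ≡ j
  distinct (inj₁ i) (inj₁ j) (inj₁ r) = cong inj₁ (distinctA i j r)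
  distinct (inj₂ i) (inj₂ j) (inj₂ s) = cong inj₂ (distinctB i j s)

count-× : ∀ {A B R S a b} → CountUpTo A R a → CountUpTo B S b →
  CountUpTo (A × B) (×-Pointwise R S) (a * b)
count-× {A} {B} {R} {S} (eA , exhaustiveA , distinctA) (eB , exhaustiveB , distinctB) =
  count-via {R = ×-Pointwise R S} *↔× (λ (i , j) → eA i , eB j)
    (λ (x , y) → (proj₁ (exhaustiveA x) , proj₁ (exhaustiveB y)) ,
                 proj₂ (exhaustiveA x) , proj₂ (exhaustiveB y))
    (λ (i , j) (i' , j') (r , s) → cong₂ _,_ (distinctA i i' r) (distinctB j j' s))

data SigRel {k : ℕ} {B : Fin k → Set} (R : ∀ i → B i → B i → Set) :
     Σ (Fin k) B → Σ (Fin k) B → Set where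
  sig : ∀ {i b b'} → R i b b' → SigRel R (i , b) (i , b')

sigRel-isEquivalence : ∀ {k} {B : Fin k → Set} {R : ∀ i → B i → B i → Set} →
  (∀ i → IsEquivalence (R i)) → IsEquivalence (SigRel R)
sigRel-isEquivalence E = record
  { refl  = sig (IsEquivalence.refl (E _))
  ; sym   = λ { (sig r) → sig (IsEquivalence.sym (E _) r) }
  ; trans = λ { (sig r) (sig r') → sig (IsEquivalence.trans (E _) r r') } }

count-Σ : ∀ k {B : Fin k → Set} {R : ∀ i → B i → B i → Set} {c : Fin k → ℕ} →
  (∀ i → IsEquivalence (R i)) → (∀ i → CountUpTo (B i) (R i) (c i)) →
  CountUpTo (Σ (Fin k) B) (SigRel R) (sum c)
count-Σ zero E C = (λ ()) , (λ ()) , λ ()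
count-Σ (suc k) {B} {R} E C =
  count-transport (⊎-isEquivalence (E zero) (sigRel-isEquivalence (E ∘ suc)))
    (sigRel-isEquivalence E) F G F-cong G-cong FG GF
    (count-⊎ (C zero) (count-Σ k (E ∘ suc) (C ∘ suc)))
  where
  F : B zero ⊎ Σ (Fin k) (B ∘ suc) → Σ (Fin (suc k)) B
  F (inj₁ b) = zero , b
  F (inj₂ (i , b)) = suc i , b
  G : Σ (Fin (suc k)) B → B zero ⊎ Σ (Fin k) (B ∘ suc)
  G (zero , b) = inj₁ b
  G (suc i , b) = inj₂ (i , b)
  F-cong : ∀ {x y} → ⊎-Pointwise (R zero) (SigRel (R ∘ suc)) x y → SigRel R (F x) (F y)
  F-cong (inj₁ r) = sig r
  F-cong (inj₂ (sig r)) = sig r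
  G-cong : ∀ {x y} → SigRel R x y → ⊎-Pointwise (R zero) (SigRel (R ∘ suc)) (G x) (G y)
  G-cong {zero , _} (sig r) = inj₁ r
  G-cong {suc i , _} (sig r) = inj₂ (sig r)
  FG : ∀ x → SigRel R (F (G x)) x
  FG (zero , b) = sig (IsEquivalence.refl (E zero))
  FG (suc i , b) = sig (IsEquivalence.refl (E (suc i)))
  GF : ∀ x → ⊎-Pointwise (R zero) (SigRel (R ∘ suc)) (G (F x)) x
  GF (inj₁ b) = inj₁ (IsEquivalence.refl (E zero))
  GF (inj₂ (i , b)) = inj₂ (sig (IsEquivalence.refl (E (suc i))))

Forest : Set
Forest = List Tree

FPos : Forest → Set
FPos [] = ⊥
FPos (t ∷ F) = Pos t ⊎ FPos F

FDesc : ∀ {F} → FPos F → FPos F → Set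
FDesc {t ∷ F} (inj₁ p) (inj₁ q) = Desc p q
FDesc {t ∷ F} (inj₁ _) (inj₂ _) = ⊥
FDesc {t ∷ F} (inj₂ _) (inj₁ _) = ⊥
FDesc {t ∷ F} (inj₂ x) (inj₂ y) = FDesc x y

FLab : Forest → ℕ → Set
FLab F N = Σ (FPos F → Fin N) λ f →
  Bijective _≡_ _≡_ f × (∀ p q → FDesc p q → toℕ (f p) < toℕ (f q))

pointwise-isEquivalence : ∀ {A B : Set} {P : (A → B) → Set} →
  IsEquivalence (λ (x y : Σ (A → B) P) → proj₁ x ≗ proj₁ y)
pointwise-isEquivalence = record
  { refl = λ _ → refl ; sym = λ r x → sym (r x) ; trans = λ r r' x → trans (r x) (r' x) }

_≈L_ : ∀ {F N} → FLab F N → FLab F N → Set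
L ≈L L' = proj₁ L ≗ proj₁ L'

≈L-isEquivalence : ∀ {F N} → IsEquivalence (_≈L_ {F} {N})
≈L-isEquivalence = pointwise-isEquivalence

removeRoot : (F : Forest) → Fin (length F) → Forest
removeRoot (t ∷ F) (suc i) = t ∷ removeRoot F i
removeRoot (leaf ∷ F) zero = F
removeRoot (node l r ∷ F) zero = l ∷ r ∷ F

root : (F : Forest) (i : Fin (length F)) → FPos F
root (t ∷ F) zero = inj₁ here
root (t ∷ F) (suc i) = inj₂ (root F i)

embed : (F : Forest) (i : Fin (length F)) → FPos (removeRoot F i) → FPos F
embed (t ∷ F) (suc i) (inj₁ p) = inj₁ p
embed (t ∷ F) (suc i) (inj₂ x) = inj₂ (embed F i x)
embed (leaf ∷ F) zero x = inj₂ x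
embed (node l r ∷ F) zero (inj₁ p) = inj₁ (left p)
embed (node l r ∷ F) zero (inj₂ (inj₁ p)) = inj₁ (right p)
embed (node l r ∷ F) zero (inj₂ (inj₂ x)) = inj₂ x

data RootView (F : Forest) (i : Fin (length F)) : FPos F → Set where
  is-root : RootView F i (root F i)
  is-kept : ∀ q → RootView F i (embed F i q)

rootView : ∀ F i x → RootView F i x
rootView (t ∷ F) (suc i) (inj₁ p) = is-kept (inj₁ p)
rootView (t ∷ F) (suc i) (inj₂ x) with rootView F i x
... | is-root = is-root
... | is-kept q = is-kept (inj₂ q)
rootView (leaf ∷ F) zero (inj₁ here) = is-root
rootView (leaf ∷ F) zero (inj₂ x) = is-kept x
rootView (node l r ∷ F) zero (inj₁ here) = is-root
rootView (node l r ∷ F) zero (inj₁ (left p)) = is-kept (inj₁ p)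
rootView (node l r ∷ F) zero (inj₁ (right p)) = is-kept (inj₂ (inj₁ p))
rootView (node l r ∷ F) zero (inj₂ x) = is-kept (inj₂ (inj₂ x))

embed≢root : ∀ F i q → embed F i q ≢ root F i
embed≢root (t ∷ F) (suc i) (inj₂ q) eq = embed≢root F i q (inj₂-injective eq)
embed≢root (leaf ∷ F) zero _ ()
embed≢root (node l r ∷ F) zero (inj₁ _) ()
embed≢root (node l r ∷ F) zero (inj₂ (inj₁ _)) ()
embed≢root (node l r ∷ F) zero (inj₂ (inj₂ _)) ()

embed-injective : ∀ F i {q q'} → embed F i q ≡ embed F i q' → q ≡ q'
embed-injective (t ∷ F) (suc i) {inj₁ p} {inj₁ .p} refl = refl
embed-injective (t ∷ F) (suc i) {inj₂ q} {inj₂ q'} eq =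
  cong inj₂ (embed-injective F i (inj₂-injective eq))
embed-injective (leaf ∷ F) zero refl = refl
embed-injective (node l r ∷ F) zero {inj₁ p} {inj₁ .p} refl = refl
embed-injective (node l r ∷ F) zero {inj₂ (inj₁ p)} {inj₂ (inj₁ .p)} refl = refl
embed-injective (node l r ∷ F) zero {inj₂ (inj₂ q)} {inj₂ (inj₂ .q)} refl = refl
embed-injective (node l r ∷ F) zero {inj₁ _} {inj₂ (inj₁ _)} ()
embed-injective (node l r ∷ F) zero {inj₁ _} {inj₂ (inj₂ _)} ()
embed-injective (node l r ∷ F) zero {inj₂ (inj₁ _)} {inj₂ (inj₂ _)} ()
embed-injective (node l r ∷ F) zero {inj₂ (inj₂ _)} {inj₂ (inj₁ _)} ()

root-injective : ∀ F {i j} → root F i ≡ root F j → i ≡ j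
root-injective (t ∷ F) {zero} {zero} _ = refl
root-injective (t ∷ F) {suc i} {suc j} eq = cong suc (root-injective F (inj₂-injective eq))

embed-FDesc : ∀ F i {q q'} → FDesc q q' → FDesc (embed F i q) (embed F i q')
embed-FDesc (t ∷ F) (suc i) {inj₁ _} {inj₁ _} d = d
embed-FDesc (t ∷ F) (suc i) {inj₂ _} {inj₂ _} d = embed-FDesc F i d
embed-FDesc (leaf ∷ F) zero d = d
embed-FDesc (node l r ∷ F) zero {inj₁ _} {inj₁ _} d = in-l d
embed-FDesc (node l r ∷ F) zero {inj₂ (inj₁ _)} {inj₂ (inj₁ _)} d = in-r d
embed-FDesc (node l r ∷ F) zero {inj₂ (inj₂ _)} {inj₂ (inj₂ _)} d = d

FDesc-embed : ∀ F i {q q'} → FDesc (embed F i q) (embed F i q') → FDesc q q'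
FDesc-embed (t ∷ F) (suc i) {inj₁ _} {inj₁ _} d = d
FDesc-embed (t ∷ F) (suc i) {inj₂ _} {inj₂ _} d = FDesc-embed F i d
FDesc-embed (leaf ∷ F) zero d = d
FDesc-embed (node l r ∷ F) zero {inj₁ _} {inj₁ _} (in-l d) = d
FDesc-embed (node l r ∷ F) zero {inj₂ (inj₁ _)} {inj₂ (inj₁ _)} (in-r d) = d
FDesc-embed (node l r ∷ F) zero {inj₂ (inj₂ _)} {inj₂ (inj₂ _)} d = d
FDesc-embed (node l r ∷ F) zero {inj₁ _} {inj₂ (inj₁ _)} ()
FDesc-embed (node l r ∷ F) zero {inj₁ _} {inj₂ (inj₂ _)} ()
FDesc-embed (node l r ∷ F) zero {inj₂ (inj₁ _)} {inj₂ (inj₂ _)} ()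
FDesc-embed (node l r ∷ F) zero {inj₂ (inj₂ _)} {inj₂ (inj₁ _)} ()

root-no-ancestor : ∀ F i x → ¬ FDesc x (root F i)
root-no-ancestor (t ∷ F) zero (inj₁ _) ()
root-no-ancestor (t ∷ F) (suc i) (inj₂ x) d = root-no-ancestor F i x d

root-or-ancestor : ∀ F x → (∃ λ i → x ≡ root F i) ⊎ (∃ λ a → FDesc {F} a x)
root-or-ancestor (t ∷ F) (inj₁ here) = inj₁ (zero , refl)
root-or-ancestor (t ∷ F) (inj₁ (left p)) = inj₂ (inj₁ here , root-l)
root-or-ancestor (t ∷ F) (inj₁ (right p)) = inj₂ (inj₁ here , root-r)
root-or-ancestor (t ∷ F) (inj₂ x) with root-or-ancestor F x
... | inj₁ (i , eq) = inj₁ (suc i , cong inj₂ eq)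
... | inj₂ (a , d) = inj₂ (inj₂ a , d)

extendFn : ∀ {N} F i → (FPos (removeRoot F i) → Fin N) → FPos F → Fin (suc N)
extendFn (t ∷ F) (suc i) g (inj₁ p) = suc (g (inj₁ p))
extendFn (t ∷ F) (suc i) g (inj₂ x) = extendFn F i (g ∘ inj₂) x
extendFn (t ∷ F) zero g (inj₁ here) = zero
extendFn (leaf ∷ F) zero g (inj₂ x) = suc (g x)
extendFn (node l r ∷ F) zero g (inj₁ (left p)) = suc (g (inj₁ p))
extendFn (node l r ∷ F) zero g (inj₁ (right p)) = suc (g (inj₂ (inj₁ p)))
extendFn (node l r ∷ F) zero g (inj₂ x) = suc (g (inj₂ (inj₂ x)))

extendFn-root : ∀ {N} F i (g : FPos (removeRoot F i) → Fin N) → extendFn F i g (root F i) ≡ zero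
extendFn-root (t ∷ F) zero g = refl
extendFn-root (t ∷ F) (suc i) g = extendFn-root F i (g ∘ inj₂)

extendFn-embed : ∀ {N} F i (g : FPos (removeRoot F i) → Fin N) q →
  extendFn F i g (embed F i q) ≡ suc (g q)
extendFn-embed (t ∷ F) (suc i) g (inj₁ p) = refl
extendFn-embed (t ∷ F) (suc i) g (inj₂ x) = extendFn-embed F i (g ∘ inj₂) x
extendFn-embed (leaf ∷ F) zero g q = refl
extendFn-embed (node l r ∷ F) zero g (inj₁ p) = refl
extendFn-embed (node l r ∷ F) zero g (inj₂ (inj₁ p)) = refl
extendFn-embed (node l r ∷ F) zero g (inj₂ (inj₂ x)) = refl

module _ {F : Forest} {N : ℕ} where

  -- The vertex labelled 0 has no ancestor (its label would be smaller), so
  -- it is a root.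
  zero-at-root : (L : FLab F (suc N)) → ∃ λ i → proj₁ L (root F i) ≡ zero
  zero-at-root (f , (_ , surjective) , increasing) with surjective zero
  ... | x , fx≡0 with root-or-ancestor F x
  ...   | inj₁ (i , refl) = i , fx≡0 refl
  ...   | inj₂ (a , a<x) =
    ⊥-elim (ℕ.n≮0 (subst (λ z → toℕ (f a) < toℕ z) (fx≡0 refl) (increasing a x a<x)))

  module Restrict (L : FLab F (suc N)) (i : Fin (length F)) (root↦0 : proj₁ L (root F i) ≡ zero) where
    private
      f = proj₁ L
      f-injective = proj₁ (proj₁ (proj₂ L))
      f-surjective = proj₂ (proj₁ (proj₂ L))
      f-increasing = proj₂ (proj₂ L)

    kept≢0 : ∀ q → zero ≢ f (embed F i q)
    kept≢0 q 0≡fq = embed≢root F i q (f-injective (trans (sym 0≡fq) (sym root↦0)))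

    g : FPos (removeRoot F i) → Fin N
    g q = punchOut (kept≢0 q)

    suc∘g : ∀ q → suc (g q) ≡ f (embed F i q)
    suc∘g q = punchIn-punchOut (kept≢0 q)

    restrict : FLab (removeRoot F i) N
    restrict = g , (g-injective , g-surjective) , g-increasing
      where
      g-injective : Injective _≡_ _≡_ g
      g-injective {q} {q'} gq≡gq' =
        embed-injective F i (f-injective (trans (sym (suc∘g q)) (trans (cong suc gq≡gq') (suc∘g q'))))
      g-surjective : Surjective _≡_ _≡_ g
      g-surjective y with f-surjective (suc y)
      ... | x , fx≡1+y with rootView F i x
      ...   | is-root = ⊥-elim (0≢1+n (trans (sym root↦0) (fx≡1+y refl)))
      ...   | is-kept q = q , λ { refl → suc-injective (trans (suc∘g q) (fx≡1+y refl)) }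
      g-increasing : ∀ q q' → FDesc q q' → toℕ (g q) < toℕ (g q')
      g-increasing q q' d = ℕ.≤-pred (subst₂ (λ a b → toℕ a < toℕ b) (sym (suc∘g q)) (sym (suc∘g q'))
                              (f-increasing _ _ (embed-FDesc F i d)))

  extend : ∀ i → FLab (removeRoot F i) N → FLab F (suc N)
  extend i (g , (g-injective , g-surjective) , g-increasing) = f , (f-injective , f-surjective) , f-increasing
    where
    f = extendFn F i g
    f-injective : Injective _≡_ _≡_ f
    f-injective {x} {y} fx≡fy with rootView F i x | rootView F i y
    ... | is-root | is-root = refl
    ... | is-root | is-kept q =
      ⊥-elim (0≢1+n (trans (sym (extendFn-root F i g)) (trans fx≡fy (extendFn-embed F i g q))))
    ... | is-kept q | is-root =
      ⊥-elim (0≢1+n (trans (sym (extendFn-root F i g)) (trans (sym fx≡fy) (extendFn-embed F i g q))))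
    ... | is-kept q | is-kept q' = cong (embed F i) (g-injective (suc-injective
      (trans (sym (extendFn-embed F i g q)) (trans fx≡fy (extendFn-embed F i g q')))))
    f-surjective : Surjective _≡_ _≡_ f
    f-surjective zero = root F i , λ { refl → extendFn-root F i g }
    f-surjective (suc y) = embed F i (proj₁ (g-surjective y)) ,
      λ { refl → trans (extendFn-embed F i g _) (cong suc (proj₂ (g-surjective y) refl)) }
    f-increasing : ∀ x y → FDesc x y → toℕ (f x) < toℕ (f y)
    f-increasing x y d with rootView F i x | rootView F i y
    ... | _ | is-root = ⊥-elim (root-no-ancestor F i x d)
    ... | is-root | is-kept q' =
      subst₂ (λ a b → toℕ a < toℕ b) (sym (extendFn-root F i g)) (sym (extendFn-embed F i g q')) (s≤s z≤n)
    ... | is-kept q | is-kept q' =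
      subst₂ (λ a b → toℕ a < toℕ b) (sym (extendFn-embed F i g q)) (sym (extendFn-embed F i g q'))
        (s≤s (g-increasing q q' (FDesc-embed F i d)))

  open Restrict using (restrict; suc∘g)

  RootChoice : Set
  RootChoice = Σ (Fin (length F)) (λ i → FLab (removeRoot F i) N)

  _≈R_ : RootChoice → RootChoice → Set
  _≈R_ = SigRel (λ i → _≈L_)

  ≈R-isEquivalence : IsEquivalence _≈R_
  ≈R-isEquivalence = sigRel-isEquivalence (λ i → ≈L-isEquivalence)

  private
    module ≈R = IsEquivalence ≈R-isEquivalence

  split : FLab F (suc N) → RootChoice
  split L = proj₁ (zero-at-root L) , restrict L _ (proj₂ (zero-at-root L))

  merge : RootChoice → FLab F (suc N)
  merge (i , G) = extend i G

  -- `split L` does not depend on how the root labelled 0 is found.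
  split-at : ∀ L i (root↦0 : proj₁ L (root F i) ≡ zero) → split L ≈R (i , restrict L i root↦0)
  split-at L i root↦0 = same-choice (proj₁ (zero-at-root L)) (proj₂ (zero-at-root L)) same-root
    where
    same-root : proj₁ (zero-at-root L) ≡ i
    same-root = root-injective F (proj₁ (proj₁ (proj₂ L)) (trans (proj₂ (zero-at-root L)) (sym root↦0)))
    same-choice : ∀ i₀ z₀ → i₀ ≡ i → (i₀ , restrict L i₀ z₀) ≈R (i , restrict L i root↦0)
    same-choice .i z₀ refl = sig λ q → suc-injective (trans (suc∘g L i z₀ q) (sym (suc∘g L i root↦0 q)))

  split-cong : ∀ {L L'} → L ≈L L' → split L ≈R split L'
  split-cong {L} {L'} L≈L' = ≈R.trans (split-at L i z)
    (≈R.trans (sig λ q → suc-injective (trans (suc∘g L i z q) (trans (L≈L' _) (sym (suc∘g L' i z' q)))))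
      (≈R.sym (split-at L' i z')))
    where
    i = proj₁ (zero-at-root L)
    z = proj₂ (zero-at-root L)
    z' : proj₁ L' (root F i) ≡ zero
    z' = trans (sym (L≈L' _)) z

  merge-cong : ∀ {x y} → x ≈R y → merge x ≈L merge y
  merge-cong {i , _} (sig G≈G') x with rootView F i x
  ... | is-root = trans (extendFn-root F i _) (sym (extendFn-root F i _))
  ... | is-kept q =
    trans (extendFn-embed F i _ q) (trans (cong suc (G≈G' q)) (sym (extendFn-embed F i _ q)))

  merge∘split : ∀ L → merge (split L) ≈L L
  merge∘split L x with rootView F (proj₁ (zero-at-root L)) x
  ... | is-root = trans (extendFn-root F _ _) (sym (proj₂ (zero-at-root L)))
  ... | is-kept q = trans (extendFn-embed F _ _ q) (suc∘g L _ (proj₂ (zero-at-root L)) q)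

  split∘merge : ∀ x → split (merge x) ≈R x
  split∘merge (i , G) = ≈R.trans (split-at (extend i G) i root↦0)
    (sig λ q → suc-injective (trans (suc∘g (extend i G) i root↦0 q) (extendFn-embed F i _ q)))
    where
    root↦0 : proj₁ (extend i G) (root F i) ≡ zero
    root↦0 = extendFn-root F i (proj₁ G)

count-step : ∀ F N {c : Fin (length F) → ℕ} →
  (∀ i → CountUpTo (FLab (removeRoot F i) N) _≈L_ (c i)) → CountUpTo (FLab F (suc N)) _≈L_ (sum c)
count-step F N C =
  count-transport (≈R-isEquivalence {F} {N}) ≈L-isEquivalence merge split
    (merge-cong {F} {N}) (split-cong {F} {N}) (merge∘split {F} {N}) (split∘merge {F} {N})
    (count-Σ (length F) (λ i → ≈L-isEquivalence) C)

forestSize : Forest → ℕ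
forestSize [] = 0
forestSize (t ∷ F) = size t + forestSize F

forestHook : Forest → ℕ
forestHook [] = 1
forestHook (t ∷ F) = hookProd t * forestHook F

forestSize-removeRoot : ∀ F i → forestSize F ≡ suc (forestSize (removeRoot F i))
forestSize-removeRoot (t ∷ F) (suc i) =
  trans (cong (size t +_) (forestSize-removeRoot F i)) (ℕ.+-suc (size t) _)
forestSize-removeRoot (leaf ∷ F) zero = refl
forestSize-removeRoot (node l r ∷ F) zero = cong suc (ℕ.+-assoc (size l) (size r) (forestSize F))

forestHook-removeRoot : ∀ F i → forestHook F ≡ size (lookup F i) * forestHook (removeRoot F i)
forestHook-removeRoot (t ∷ F) (suc i) =
  trans (cong (hookProd t *_) (forestHook-removeRoot F i))
        (left-comm (hookProd t) (size (lookup F i)) (forestHook (removeRoot F i)))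
  where
  left-comm : ∀ a b c → a * (b * c) ≡ b * (a * c)
  left-comm = solve-∀
forestHook-removeRoot (leaf ∷ F) zero = refl
forestHook-removeRoot (node l r ∷ F) zero =
  trans (ℕ.*-assoc (size (node l r) * hookProd l) (hookProd r) (forestHook F))
        (ℕ.*-assoc (size (node l r)) (hookProd l) _)

sum-size : ∀ F → sum (λ i → size (lookup F i)) ≡ forestSize F
sum-size [] = refl
sum-size (t ∷ F) = cong (size t +_) (sum-size F)

-- The number of increasing labellings of F by N labels, computed by the
-- root-removal recursion (the smallest label sits on some root).
labCount : ℕ → Forest → ℕ
labCount zero F = 1
labCount (suc N) F = sum (λ i → labCount N (removeRoot F i))

count-FLab : ∀ N F → forestSize F ≡ N → CountUpTo (FLab F N) _≈L_ (labCount N F)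
count-FLab zero [] refl = (λ _ → empty) , (λ _ → zero , λ ()) , λ { zero zero _ → refl }
  where
  empty : FLab [] zero
  empty = (λ ()) , ((λ {x} → ⊥-elim x) , λ ()) , λ ()
count-FLab zero (leaf ∷ _) ()
count-FLab zero (node _ _ ∷ _) ()
count-FLab (suc N) F |F|≡1+N = count-step F N λ i →
  count-FLab N (removeRoot F i) (ℕ.suc-injective (trans (sym (forestSize-removeRoot F i)) |F|≡1+N))

-- Hook length formula for forests: (∏ hooks) · #labellings = N!.  By
-- induction on N: removing root i divides the hook product by the size of
-- tree i, and these sizes sum to N.
hook-length-forest : ∀ N F → forestSize F ≡ N → forestHook F * labCount N F ≡ N !
hook-length-forest zero [] refl = refl
hook-length-forest zero (leaf ∷ _) ()
hook-length-forest zero (node _ _ ∷ _) ()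
hook-length-forest (suc N) F |F|≡1+N = begin
  forestHook F * sum (λ i → labCount N (removeRoot F i)) ≡⟨ *-distribˡ-sum {length F} (forestHook F) _ ⟩
  sum (λ i → forestHook F * labCount N (removeRoot F i)) ≡⟨ sum-cong-≗ term ⟩
  sum (λ i → size (lookup F i) * N !)                   ≡⟨ *-distribʳ-sum {length F} (N !) _ ⟨
  sum (λ i → size (lookup F i)) * N !                   ≡⟨ cong (_* N !) (trans (sum-size F) |F|≡1+N) ⟩
  suc N * N ! ∎
  where
  term : ∀ i → forestHook F * labCount N (removeRoot F i) ≡ size (lookup F i) * N !
  term i = begin
    forestHook F * labCount N F'                          ≡⟨ cong (_* labCount N F') (forestHook-removeRoot F i) ⟩
    size (lookup F i) * forestHook F' * labCount N F'     ≡⟨ ℕ.*-assoc (size (lookup F i)) _ _ ⟩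
    size (lookup F i) * (forestHook F' * labCount N F')   ≡⟨ cong (size (lookup F i) *_)
      (hook-length-forest N F' (ℕ.suc-injective (trans (sym (forestSize-removeRoot F i)) |F|≡1+N))) ⟩
    size (lookup F i) * N ! ∎
    where F' = removeRoot F i

module _ (s : Tree) where
  private
    [s] : Forest
    [s] = s ∷ []

  toForest : IncLab s → FLab [s] (size s)
  toForest (f , (f-injective , f-surjective) , f-increasing) = f' , (f'-injective , f'-surjective) , f'-increasing
    where
    f' : FPos [s] → Fin (size s)
    f' (inj₁ p) = f p
    f'-injective : Injective _≡_ _≡_ f'
    f'-injective {inj₁ p} {inj₁ q} eq = cong inj₁ (f-injective eq)
    f'-surjective : Surjective _≡_ _≡_ f'
    f'-surjective y = inj₁ (proj₁ (f-surjective y)) , λ { refl → proj₂ (f-surjective y) refl }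
    f'-increasing : ∀ p q → FDesc p q → toℕ (f' p) < toℕ (f' q)
    f'-increasing (inj₁ p) (inj₁ q) = f-increasing p q

  fromForest : FLab [s] (size s) → IncLab s
  fromForest (f , (f-injective , f-surjective) , f-increasing) =
    f ∘ inj₁ , (inj₁-injective ∘ f-injective , f'-surjective) , λ p q → f-increasing (inj₁ p) (inj₁ q)
    where
    f'-surjective : Surjective _≡_ _≡_ (f ∘ inj₁)
    f'-surjective y with f-surjective y
    ... | inj₁ p , fp≡y = p , λ { refl → fp≡y refl }

  hook-length-formula : ∀ {c} → HasCount s c → hookProd s * c ≡ size s !
  hook-length-formula {c} C = begin
    hookProd s * c                       ≡⟨ cong (hookProd s *_) (count-unique pointwise-isEquivalence C C') ⟩
    hookProd s * labCount (size s) [s]   ≡⟨ cong (_* labCount (size s) [s]) (ℕ.*-identityʳ (hookProd s)) ⟨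
    forestHook [s] * labCount (size s) [s] ≡⟨ hook-length-forest (size s) [s] |[s]| ⟩
    size s ! ∎
    where
    |[s]| : forestSize [s] ≡ size s
    |[s]| = ℕ.+-identityʳ (size s)
    C' : HasCount s (labCount (size s) [s])
    C' = count-transport ≈L-isEquivalence pointwise-isEquivalence fromForest toForest
      (λ r p → r (inj₁ p)) (λ { r (inj₁ p) → r p }) (λ _ _ → refl) (λ { _ (inj₁ _) → refl })
      (count-FLab (size s) [s] |[s]|)

internal : Tree → ℕ
internal leaf = 0
internal (node l r) = suc (internal l + internal r)

size≡2internal+1 : ∀ t → size t ≡ 2 * internal t + 1
size≡2internal+1 leaf = refl
size≡2internal+1 (node l r)
  rewrite size≡2internal+1 l | size≡2internal+1 r = combine (internal l) (internal r)
  where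
  combine : ∀ a b → suc (2 * a + 1 + (2 * b + 1)) ≡ 2 * suc (a + b) + 1
  combine = solve-∀

TreesWith : ℕ → Set
TreesWith k = Σ Tree (λ t → internal t ≡ k)

_≈T_ : ∀ {k} → TreesWith k → TreesWith k → Set
t ≈T t' = proj₁ t ≡ proj₁ t'

≈T-isEquivalence : ∀ {k} → IsEquivalence (_≈T_ {k})
≈T-isEquivalence = record { refl = refl ; sym = sym ; trans = trans }

SubtreePairs : ℕ → Set
SubtreePairs k = Σ (Fin (suc k)) (λ i → TreesWith (toℕ i) × TreesWith (k ∸ toℕ i))

_≈P_ : ∀ {k} → SubtreePairs k → SubtreePairs k → Set
_≈P_ = SigRel (λ i → ×-Pointwise _≈T_ _≈T_)

module _ {k : ℕ} where

  join : SubtreePairs k → TreesWith (suc k)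
  join (i , (l , |l|≡i) , (r , |r|≡k-i)) =
    node l r , cong suc (trans (cong₂ _+_ |l|≡i |r|≡k-i) (ℕ.m+[n∸m]≡n (ℕ.≤-pred (toℕ<n i))))

  unjoin : TreesWith (suc k) → SubtreePairs k
  unjoin (node l r , |t|≡1+k) = fromℕ< |l|<1+k , (l , sym (toℕ-fromℕ< |l|<1+k)) , (r , |r|≡k-i)
    where
    |l|+|r|≡k : internal l + internal r ≡ k
    |l|+|r|≡k = ℕ.suc-injective |t|≡1+k
    |l|<1+k : internal l < suc k
    |l|<1+k = s≤s (subst (internal l ≤_) |l|+|r|≡k (ℕ.m≤m+n (internal l) (internal r)))
    |r|≡k-i : internal r ≡ k ∸ toℕ (fromℕ< |l|<1+k)
    |r|≡k-i = trans (sym (ℕ.m+n∸m≡n (internal l) (internal r)))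
                    (cong₂ _∸_ |l|+|r|≡k (sym (toℕ-fromℕ< |l|<1+k)))

  join-cong : ∀ {x y} → x ≈P y → join x ≈T join y
  join-cong (sig (l≡l' , r≡r')) = cong₂ node l≡l' r≡r'

  unjoin-cong : ∀ {t t'} → t ≈T t' → unjoin t ≈P unjoin t'
  unjoin-cong {node l r , _} {node .l .r , _} refl = sig (refl , refl)

  join∘unjoin : ∀ t → join (unjoin t) ≈T t
  join∘unjoin (node l r , _) = refl

  unjoin∘join : ∀ x → unjoin (join x) ≈P x
  unjoin∘join (i , (l , |l|≡i) , (r , _)) = same-index (fromℕ< _)
    (trans (fromℕ<-cong (internal l) (toℕ i) |l|≡i _ (toℕ<n i)) (fromℕ<-toℕ i (toℕ<n i)))
    where
    same-index : ∀ i' {a b} → i' ≡ i → (i' , (l , a) , (r , b)) ≈P (i , (l , |l|≡i) , (r , _))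
    same-index .i refl = sig (refl , refl)

count-trees-suc : ∀ k {cˡ cʳ : Fin (suc k) → ℕ} →
  (∀ i → CountUpTo (TreesWith (toℕ i)) _≈T_ (cˡ i)) →
  (∀ i → CountUpTo (TreesWith (k ∸ toℕ i)) _≈T_ (cʳ i)) →
  CountUpTo (TreesWith (suc k)) _≈T_ (sum (λ i → cˡ i * cʳ i))
count-trees-suc k Cˡ Cʳ =
  count-transport (sigRel-isEquivalence (λ i → ×-isEquivalence ≈T-isEquivalence ≈T-isEquivalence))
    ≈T-isEquivalence join unjoin join-cong unjoin-cong join∘unjoin unjoin∘join
    (count-Σ (suc k) (λ i → ×-isEquivalence ≈T-isEquivalence ≈T-isEquivalence)
      (λ i → count-× {R = _≈T_} {S = _≈T_} (Cˡ i) (Cʳ i)))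

count-trees-zero : CountUpTo (TreesWith 0) _≈T_ 1
count-trees-zero = (λ _ → leaf , refl) , (λ { (leaf , _) → zero , refl }) , λ { zero zero _ → refl }

count-trees : ∀ k → ∃ λ c → CountUpTo (TreesWith k) _≈T_ c
count-trees = <-rec _ λ where
  zero _ → 1 , count-trees-zero
  (suc k) IH → _ , count-trees-suc k (λ i → proj₂ (IH (s≤s (ℕ.≤-pred (toℕ<n i)))))
                                     (λ i → proj₂ (IH (s≤s (ℕ.m∸n≤m k (toℕ i)))))

catalan : ℕ → ℕ
catalan k = proj₁ (count-trees k)

catalan-count : ∀ k → CountUpTo (TreesWith k) _≈T_ (catalan k)
catalan-count k = proj₂ (count-trees k)

catalan-zero : catalan 0 ≡ 1
catalan-zero = count-unique ≈T-isEquivalence (catalan-count 0) count-trees-zero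

catalan-suc : ∀ k → catalan (suc k) ≡ sum (λ (i : Fin (suc k)) → catalan (toℕ i) * catalan (k ∸ toℕ i))
catalan-suc k = count-unique ≈T-isEquivalence (catalan-count (suc k))
  (count-trees-suc k (λ i → catalan-count (toℕ i)) (λ i → catalan-count (k ∸ toℕ i)))


conv : (ℕ → ℕ) → (ℕ → ℕ) → ℕ → ℕ
conv f g zero = f 0 * g 0
conv f g (suc k) = f 0 * g (suc k) + conv (f ∘ suc) g k

sum≡conv : ∀ k f g → sum (λ (i : Fin (suc k)) → f (toℕ i) * g (k ∸ toℕ i)) ≡ conv f g k
sum≡conv zero f g = ℕ.+-identityʳ _
sum≡conv (suc k) f g = cong (f 0 * g (suc k) +_) (sum≡conv k (f ∘ suc) g)

conv-cong : ∀ k {f f' g} → (∀ i → i ≤ k → f i ≡ f' i) → conv f g k ≡ conv f' g k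
conv-cong zero f≗f' = cong (_* _) (f≗f' 0 z≤n)
conv-cong (suc k) f≗f' = cong₂ _+_ (cong (_* _) (f≗f' 0 z≤n)) (conv-cong k (λ i i≤k → f≗f' (suc i) (s≤s i≤k)))

conv-+ : ∀ k f h g → conv (λ i → f i + h i) g k ≡ conv f g k + conv h g k
conv-+ zero f h g = ℕ.*-distribʳ-+ (g 0) (f 0) (h 0)
conv-+ (suc k) f h g = begin
  (f 0 + h 0) * g (suc k) + conv (λ i → f (suc i) + h (suc i)) g k
    ≡⟨ cong₂ _+_ (ℕ.*-distribʳ-+ (g (suc k)) (f 0) (h 0)) (conv-+ k (f ∘ suc) (h ∘ suc) g) ⟩
  (f 0 * g (suc k) + h 0 * g (suc k)) + (conv (f ∘ suc) g k + conv (h ∘ suc) g k)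
    ≡⟨ interchange (f 0 * g (suc k)) (h 0 * g (suc k)) _ _ ⟩
  (f 0 * g (suc k) + conv (f ∘ suc) g k) + (h 0 * g (suc k) + conv (h ∘ suc) g k) ∎
  where
  interchange : ∀ a b c d → (a + b) + (c + d) ≡ (a + c) + (b + d)
  interchange = solve-∀

conv-* : ∀ k c f g → conv (λ i → c * f i) g k ≡ c * conv f g k
conv-* zero c f g = ℕ.*-assoc c (f 0) (g 0)
conv-* (suc k) c f g = begin
  c * f 0 * g (suc k) + conv (λ i → c * f (suc i)) g k
    ≡⟨ cong₂ _+_ (ℕ.*-assoc c (f 0) _) (conv-* k c (f ∘ suc) g) ⟩
  c * (f 0 * g (suc k)) + c * conv (f ∘ suc) g k
    ≡⟨ ℕ.*-distribˡ-+ c _ _ ⟨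
  c * (f 0 * g (suc k) + conv (f ∘ suc) g k) ∎

conv-last : ∀ k f g → conv f g (suc k) ≡ conv f (g ∘ suc) k + f (suc k) * g 0
conv-last zero f g = refl
conv-last (suc k) f g = begin
  f 0 * g (suc (suc k)) + conv (f ∘ suc) g (suc k)
    ≡⟨ cong (f 0 * g (suc (suc k)) +_) (conv-last k (f ∘ suc) g) ⟩
  f 0 * g (suc (suc k)) + (conv (f ∘ suc) (g ∘ suc) k + f (suc (suc k)) * g 0)
    ≡⟨ ℕ.+-assoc (f 0 * g (suc (suc k))) _ _ ⟨
  f 0 * g (suc (suc k)) + conv (f ∘ suc) (g ∘ suc) k + f (suc (suc k)) * g 0 ∎

conv-comm : ∀ k f g → conv f g k ≡ conv g f k
conv-comm zero f g = ℕ.*-comm (f 0) (g 0)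
conv-comm (suc k) f g = begin
  f 0 * g (suc k) + conv (f ∘ suc) g k ≡⟨ cong (f 0 * g (suc k) +_) (conv-comm k (f ∘ suc) g) ⟩
  f 0 * g (suc k) + conv g (f ∘ suc) k ≡⟨ ℕ.+-comm (f 0 * g (suc k)) _ ⟩
  conv g (f ∘ suc) k + f 0 * g (suc k) ≡⟨ cong (conv g (f ∘ suc) k +_) (ℕ.*-comm (f 0) _) ⟩
  conv g (f ∘ suc) k + g (suc k) * f 0 ≡⟨ conv-last k g f ⟨
  conv g f (suc k) ∎

conv-weight : ∀ k f g → conv (λ i → i * f i) g k + conv f (λ j → j * g j) k ≡ k * conv f g k
conv-weight zero f g = base (f 0) (g 0)
  where
  base : ∀ a b → 0 * a * b + a * (0 * b) ≡ 0 * (a * b)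
  base = solve-∀
conv-weight (suc k) f g = begin
  (0 * f 0 * g (suc k) + conv (λ i → suc i * f (suc i)) g k) + (f 0 * (suc k * g (suc k)) + W)
    ≡⟨ cong (λ z → (0 * f 0 * g (suc k) + z) + (f 0 * (suc k * g (suc k)) + W))
         (conv-+ k (f ∘ suc) (λ i → i * f (suc i)) g) ⟩
  (0 * f 0 * g (suc k) + (P + Q)) + (f 0 * (suc k * g (suc k)) + W)
    ≡⟨ regroup (f 0) (g (suc k)) k P Q W ⟩
  P + f 0 * (suc k * g (suc k)) + (Q + W)
    ≡⟨ cong (P + f 0 * (suc k * g (suc k)) +_) (conv-weight k (f ∘ suc) g) ⟩
  P + f 0 * (suc k * g (suc k)) + k * P
    ≡⟨ collect (f 0) (g (suc k)) k P ⟩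
  suc k * (f 0 * g (suc k) + P) ∎
  where
  P = conv (f ∘ suc) g k
  Q = conv (λ i → i * f (suc i)) g k
  W = conv (f ∘ suc) (λ j → j * g j) k
  regroup : ∀ x y k P Q W → (0 * x * y + (P + Q)) + (x * (suc k * y) + W) ≡ P + x * (suc k * y) + (Q + W)
  regroup = solve-∀
  collect : ∀ x y k P → P + x * (suc k * y) + k * P ≡ suc k * (x * y + P)
  collect = solve-∀

private
  c : ℕ → ℕ
  c = catalan

catalan-conv : ∀ k → c (suc k) ≡ conv c c k
catalan-conv k = trans (catalan-suc k) (sum≡conv k c c)

-- By symmetry, the weights i and j = k - i contribute equally:
-- 2 ∑ i c_i c_{k-i} = k c_{k+1}.
catalan-weight : ∀ k → 2 * conv (λ i → i * c i) c k ≡ k * c (suc k)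
catalan-weight k = begin
  2 * Y                                   ≡⟨ cong (Y +_) (ℕ.+-identityʳ Y) ⟩
  Y + Y                                   ≡⟨ cong (Y +_) (conv-comm k _ c) ⟩
  Y + conv c (λ i → i * c i) k            ≡⟨ conv-weight k c c ⟩
  k * conv c c k                          ≡⟨ cong (k *_) (catalan-conv k) ⟨
  k * c (suc k) ∎
  where Y = conv (λ i → i * c i) c k

catalan-shifted : ∀ k → suc (suc k) * c (suc k) ≡ 2 * conv (λ i → suc i * c i) c k
catalan-shifted k = begin
  suc (suc k) * X                                ≡⟨ split-off k X ⟩
  2 * X + k * X                                  ≡⟨ cong (2 * X +_) (catalan-weight k) ⟨
  2 * X + 2 * Y                                  ≡⟨ ℕ.*-distribˡ-+ 2 X Y ⟨
  2 * (X + Y)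
    ≡⟨ cong (2 *_) (trans (cong (_+ Y) (catalan-conv k)) (sym (conv-+ k c (λ i → i * c i) c))) ⟩
  2 * conv (λ i → suc i * c i) c k ∎
  where
  X = c (suc k)
  Y = conv (λ i → i * c i) c k
  split-off : ∀ k x → suc (suc k) * x ≡ 2 * x + k * x
  split-off = solve-∀

-- The ratio of consecutive Catalan numbers: (k+2) c_{k+1} = 2(2k+1) c_k.
-- By strong induction: inserting the ratio for all i < k into the
-- right-hand side of `catalan-shifted` gives (2k+1) c_k.
catalan-ratio : ∀ k → suc (suc k) * c (suc k) ≡ 2 * ((2 * k + 1) * c k)
catalan-ratio = <-rec _ λ k IH → trans (catalan-shifted k) (cong (2 *_) (weighted-sum k IH))
  where
  weighted-sum : ∀ k → (∀ {i} → i < k → suc (suc i) * c (suc i) ≡ 2 * ((2 * i + 1) * c i)) →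
    conv (λ i → suc i * c i) c k ≡ (2 * k + 1) * c k
  weighted-sum zero _ = cong (λ x → (x + 0) * x) catalan-zero
  weighted-sum (suc m) IH = begin
    (c 0 + 0) * c (suc m) + conv (λ i → suc (suc i) * c (suc i)) c m
      ≡⟨ cong₂ _+_ (cong (λ x → (x + 0) * c (suc m)) catalan-zero)
                   (conv-cong m (λ i i≤m → IH (s≤s i≤m))) ⟩
    1 * c (suc m) + conv (λ i → 2 * ((2 * i + 1) * c i)) c m
      ≡⟨ cong (1 * c (suc m) +_) (conv-* m 2 _ c) ⟩
    1 * c (suc m) + 2 * conv (λ i → (2 * i + 1) * c i) c m
      ≡⟨ cong (λ z → 1 * c (suc m) + 2 * z) odd-weights ⟩
    1 * c (suc m) + 2 * (c (suc m) + m * c (suc m))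
      ≡⟨ collect m (c (suc m)) ⟩
    (2 * suc m + 1) * c (suc m) ∎
    where
    odd-weights : conv (λ i → (2 * i + 1) * c i) c m ≡ c (suc m) + m * c (suc m)
    odd-weights = begin
      conv (λ i → (2 * i + 1) * c i) c m         ≡⟨ conv-cong m (λ i _ → expand i (c i)) ⟩
      conv (λ i → c i + 2 * (i * c i)) c m       ≡⟨ conv-+ m c _ c ⟩
      conv c c m + conv (λ i → 2 * (i * c i)) c m ≡⟨ cong₂ _+_ (sym (catalan-conv m)) (conv-* m 2 (λ i → i * c i) c) ⟩
      c (suc m) + 2 * conv (λ i → i * c i) c m  ≡⟨ cong (c (suc m) +_) (catalan-weight m) ⟩
      c (suc m) + m * c (suc m) ∎
      where
      expand : ∀ i x → (2 * i + 1) * x ≡ x + 2 * (i * x)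
      expand = solve-∀
    collect : ∀ m y → 1 * y + 2 * (y + m * y) ≡ (2 * suc m + 1) * y
    collect = solve-∀

catalan-closed : ∀ n → suc n ! * c n ≡ 2 ^ n * oddProd n
catalan-closed zero = cong (1 *_) catalan-zero
catalan-closed (suc n) = begin
  (suc (suc n) * suc n !) * c (suc n)        ≡⟨ reassoc (suc (suc n)) (suc n !) (c (suc n)) ⟩
  suc n ! * (suc (suc n) * c (suc n))        ≡⟨ cong (suc n ! *_) (catalan-ratio n) ⟩
  suc n ! * (2 * ((2 * n + 1) * c n))        ≡⟨ pull-out (suc n !) (2 * n + 1) (c n) ⟩
  2 * (2 * n + 1) * (suc n ! * c n)          ≡⟨ cong (2 * (2 * n + 1) *_) (catalan-closed n) ⟩
  2 * (2 * n + 1) * (2 ^ n * oddProd n)      ≡⟨ regroup (2 * n + 1) (2 ^ n) (oddProd n) ⟩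
  2 * 2 ^ n * (oddProd n * (2 * n + 1)) ∎
  where
  reassoc : ∀ a b x → (a * b) * x ≡ b * (a * x)
  reassoc = solve-∀
  pull-out : ∀ a b x → a * (2 * (b * x)) ≡ 2 * b * (a * x)
  pull-out = solve-∀
  regroup : ∀ a p o → 2 * a * (p * o) ≡ 2 * p * (o * a)
  regroup = solve-∀

odd-factorial : ∀ n → (2 * n + 1) ! ≡ 2 ^ n * n ! * oddProd (suc n)
odd-factorial zero = refl
odd-factorial (suc n) = begin
  (2 * suc n + 1) !                                   ≡⟨ cong _! (shift n) ⟩
  suc (suc (2 * n + 1)) * (suc (2 * n + 1) * (2 * n + 1) !)
    ≡⟨ cong (λ z → suc (suc (2 * n + 1)) * (suc (2 * n + 1) * z)) (odd-factorial n) ⟩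
  suc (suc (2 * n + 1)) * (suc (2 * n + 1) * (2 ^ n * n ! * (oddProd n * (2 * n + 1))))
    ≡⟨ regroup n (2 ^ n) (n !) (oddProd n) ⟩
  2 * 2 ^ n * (suc n * n !) * (oddProd n * (2 * n + 1) * (2 * suc n + 1)) ∎
  where
  shift : ∀ n → 2 * suc n + 1 ≡ suc (suc (2 * n + 1))
  shift = solve-∀
  regroup : ∀ n p f o → suc (suc (2 * n + 1)) * (suc (2 * n + 1) * (p * f * (o * (2 * n + 1))))
                      ≡ 2 * p * (suc n * f) * (o * (2 * n + 1) * (2 * suc n + 1))
  regroup = solve-∀

catalan-identity : ∀ n → (n + 1) * c n * (2 * n + 1) ! ≡ 2 ^ (2 * n) * (oddProd n * oddProd (suc n))
catalan-identity n = begin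
  (n + 1) * c n * (2 * n + 1) !                          ≡⟨ cong ((n + 1) * c n *_) (odd-factorial n) ⟩
  (n + 1) * c n * (2 ^ n * n ! * oddProd (suc n))        ≡⟨ regroup (n + 1) (c n) (2 ^ n) (n !) (oddProd (suc n)) ⟩
  2 ^ n * ((n + 1) * n ! * c n) * oddProd (suc n)        ≡⟨ cong (λ z → 2 ^ n * (z * n ! * c n) * oddProd (suc n)) (ℕ.+-comm n 1) ⟩
  2 ^ n * (suc n ! * c n) * oddProd (suc n)              ≡⟨ cong (λ z → 2 ^ n * z * oddProd (suc n)) (catalan-closed n) ⟩
  2 ^ n * (2 ^ n * oddProd n) * oddProd (suc n)          ≡⟨ regroup' (2 ^ n) (oddProd n) (oddProd (suc n)) ⟩
  (2 ^ n * 2 ^ n) * (oddProd n * oddProd (suc n))        ≡⟨ cong (_* (oddProd n * oddProd (suc n))) 4ⁿ ⟨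
  2 ^ (2 * n) * (oddProd n * oddProd (suc n)) ∎
  where
  regroup : ∀ a x p f o → a * x * (p * f * o) ≡ p * ((a * f) * x) * o
  regroup = solve-∀
  regroup' : ∀ p a b → p * (p * a) * b ≡ (p * p) * (a * b)
  regroup' = solve-∀
  4ⁿ : 2 ^ (2 * n) ≡ 2 ^ n * 2 ^ n
  4ⁿ = trans (cong (λ m → 2 ^ (n + m)) (ℕ.+-identityʳ n)) (ℕ.^-distribˡ-+-* 2 n n)

-- Pivoting is an equivalence relation preserving the hook product (a
-- pivot only reorders the factors of hookProd).
pivot-sym : ∀ {s t} → Pivot s t → Pivot t s
pivot-sym swap = swap
pivot-sym (in-l p) = in-l (pivot-sym p)
pivot-sym (in-r p) = in-r (pivot-sym p)

~-isEquivalence : IsEquivalence _~_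
~-isEquivalence = record { refl = ε ; sym = reverse pivot-sym ; trans = _◅◅_ }

pivot-size : ∀ {s t} → Pivot s t → size s ≡ size t
pivot-size (swap {l} {r}) = cong suc (ℕ.+-comm (size l) (size r))
pivot-size (in-l {r = r} p) = cong (λ z → suc (z + size r)) (pivot-size p)
pivot-size (in-r {l = l} p) = cong (λ z → suc (size l + z)) (pivot-size p)

pivot-hookProd : ∀ {s t} → Pivot s t → hookProd s ≡ hookProd t
pivot-hookProd (swap {l} {r}) = swapped (size l) (size r) (hookProd l) (hookProd r)
  where
  swapped : ∀ a b x y → suc (a + b) * x * y ≡ suc (b + a) * y * x
  swapped = solve-∀
pivot-hookProd (in-l {r = r} p) = cong₂ (λ n h → suc (n + size r) * h * hookProd r) (pivot-size p) (pivot-hookProd p)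
pivot-hookProd (in-r {l = l} p) = cong₂ (λ n h → suc (size l + n) * hookProd l * h) (pivot-size p) (pivot-hookProd p)

~-hookProd : ∀ {s t} → s ~ t → hookProd s ≡ hookProd t
~-hookProd ε = refl
~-hookProd (p ◅ ps) = trans (pivot-hookProd p) (~-hookProd ps)

private
  variable
    A B : Set

sum-cong : ∀ {f g : A → ℕ} xs → (∀ x → x ∈ xs → f x ≡ g x) → sumℕ (map f xs) ≡ sumℕ (map g xs)
sum-cong [] _ = refl
sum-cong (x ∷ xs) f≗g = cong₂ _+_ (f≗g x (here refl)) (sum-cong xs (λ y y∈xs → f≗g y (there y∈xs)))

sum-+ : ∀ (f g : A → ℕ) xs → sumℕ (map (λ x → f x + g x) xs) ≡ sumℕ (map f xs) + sumℕ (map g xs)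
sum-+ f g [] = refl
sum-+ f g (x ∷ xs) = trans (cong (f x + g x +_) (sum-+ f g xs)) (interchange (f x) (g x) _ _)
  where
  interchange : ∀ a b c d → a + b + (c + d) ≡ a + c + (b + d)
  interchange = solve-∀

sum-*ˡ : ∀ a (f : A → ℕ) xs → sumℕ (map (λ x → a * f x) xs) ≡ a * sumℕ (map f xs)
sum-*ˡ a f [] = sym (ℕ.*-zeroʳ a)
sum-*ˡ a f (x ∷ xs) = trans (cong (a * f x +_) (sum-*ˡ a f xs)) (sym (ℕ.*-distribˡ-+ a (f x) _))

sum-zero : ∀ (ys : List B) → sumℕ (map (λ _ → 0) ys) ≡ 0
sum-zero [] = refl
sum-zero (_ ∷ ys) = sum-zero ys

sum-ones : ∀ (f : A → ℕ) xs → (∀ x → x ∈ xs → f x ≡ 1) → sumℕ (map f xs) ≡ length xs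
sum-ones f xs f≡1 = trans (sum-cong xs f≡1) (all-ones xs)
  where
  all-ones : ∀ xs → sumℕ (map (λ _ → 1) xs) ≡ length xs
  all-ones [] = refl
  all-ones (_ ∷ xs) = cong suc (all-ones xs)

sum-swap : ∀ (f : A → B → ℕ) xs ys →
  sumℕ (map (λ y → sumℕ (map (λ x → f x y) xs)) ys) ≡ sumℕ (map (λ x → sumℕ (map (f x) ys)) xs)
sum-swap f [] ys = sum-zero ys
sum-swap f (x ∷ xs) ys =
  trans (sum-+ (f x) (λ y → sumℕ (map (λ x' → f x' y) xs)) ys) (cong (sumℕ (map (f x) ys) +_) (sum-swap f xs ys))

indicator : ∀ {P : Set} → Dec P → ℕ
indicator (yes _) = 1
indicator (no _) = 0

length-filter : ∀ {P : A → Set} (P? : ∀ x → Dec (P x)) xs →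
  length (filter P? xs) ≡ sumℕ (map (λ x → indicator (P? x)) xs)
length-filter P? [] = refl
length-filter P? (x ∷ xs) with P? x
... | yes _ = cong suc (length-filter P? xs)
... | no _ = length-filter P? xs

module ClassCounting {A : Set} {_≈_ : A → A → Set} (≈-equiv : IsEquivalence _≈_)
                     (_≈?_ : ∀ x y → Dec (x ≈ y)) where
  private module ≈ = IsEquivalence ≈-equiv

  classIn : List A → A → List A
  classIn xs y = filter (λ x → x ≈? y) xs

  class-sum : ∀ a (g : A → ℕ) K y xs → (∀ x → x ∈ xs → x ≈ y → a * g x ≡ K) →
    a * sumℕ (map g (classIn xs y)) ≡ K * length (classIn xs y)
  class-sum a g K y [] _ = trans (ℕ.*-zeroʳ a) (sym (ℕ.*-zeroʳ K))
  class-sum a g K y (x ∷ xs) ag≡K with x ≈? y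
  ... | yes x≈y = begin
    a * (g x + sumℕ (map g (classIn xs y)))         ≡⟨ ℕ.*-distribˡ-+ a (g x) _ ⟩
    a * g x + a * sumℕ (map g (classIn xs y))       ≡⟨ cong₂ _+_ (ag≡K x (here refl) x≈y)
                                                        (class-sum a g K y xs (λ x' m → ag≡K x' (there m))) ⟩
    K + K * length (classIn xs y)                   ≡⟨ ℕ.*-suc K _ ⟨
    K * suc (length (classIn xs y)) ∎
  ... | no _ = class-sum a g K y xs (λ x' m → ag≡K x' (there m))

  no-match : ∀ x r ys → All (λ b → ¬ r ≈ b) ys → x ≈ r → length (filter (x ≈?_) ys) ≡ 0
  no-match x r [] _ _ = refl
  no-match x r (b ∷ ys) (r≉b ∷ r≉ys) x≈r with x ≈? b
  ... | yes x≈b = ⊥-elim (r≉b (≈.trans (≈.sym x≈r) x≈b))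
  ... | no _ = no-match x r ys r≉ys x≈r

  one-match : ∀ x r ys → AllPairs (λ a b → ¬ a ≈ b) ys → r ∈ ys → x ≈ r → length (filter (x ≈?_) ys) ≡ 1
  one-match x r (b ∷ ys) (b≉ys ∷ distinct) r∈ys x≈r with x ≈? b | r∈ys
  ... | yes x≈b | here refl = cong suc (no-match x b ys b≉ys x≈b)
  ... | yes x≈b | there r∈ys' = ⊥-elim (All.lookup b≉ys r∈ys' (≈.trans (≈.sym x≈b) x≈r))
  ... | no x≉b | here refl = ⊥-elim (x≉b x≈r)
  ... | no _ | there r∈ys' = one-match x r ys distinct r∈ys' x≈r

  sum-class-sizes : ∀ xs ys → AllPairs (λ a b → ¬ a ≈ b) ys →
    (∀ x → x ∈ xs → ∃ λ r → r ∈ ys × x ≈ r) →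
    sumℕ (map (λ y → length (classIn xs y)) ys) ≡ length xs
  sum-class-sizes xs ys distinct covers = begin
    sumℕ (map (λ y → length (classIn xs y)) ys)
      ≡⟨ sum-cong ys (λ y _ → length-filter (_≈? y) xs) ⟩
    sumℕ (map (λ y → sumℕ (map (λ x → indicator (x ≈? y)) xs)) ys)
      ≡⟨ sum-swap (λ x y → indicator (x ≈? y)) xs ys ⟩
    sumℕ (map (λ x → sumℕ (map (λ y → indicator (x ≈? y)) ys)) xs)
      ≡⟨ sum-cong xs (λ x _ → length-filter (x ≈?_) ys) ⟨
    sumℕ (map (λ x → length (filter (x ≈?_) ys)) xs)
      ≡⟨ sum-ones _ xs (λ x x∈xs → let (r , r∈ys , x≈r) = covers x x∈xs in one-match x r ys distinct r∈ys x≈r) ⟩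
    length xs ∎

-- The embedding `+_ : ℕ → ℤ` is brought into scope only here: it would make
-- the sections `(m +_)` of ℕ-addition used above ambiguous.
open import Data.Integer using (+_)

-- Arithmetic of non-negative fractions + a / d, computed in the
-- unnormalised rationals, where + a / (d+1) is represented by `frac a d`.
private
  frac : ℕ → ℕ → ℚᵘ
  frac a d = mkℚᵘ (+ a) d

  toℚᵘ-/ : ∀ a d → toℚᵘ (+ a / suc d) ≃ frac a d
  toℚᵘ-/ a d = toℚᵘ-fromℚᵘ (frac a d)

/-*ˡ : ∀ a b d .{{_ : NonZero d}} → (+ a / 1) ℚ.* (+ b / d) ≡ + (a * b) / d
/-*ˡ a b (suc d) = toℚᵘ-injective (ℚᵘ.≃-trans (toℚᵘ-homo-* (+ a / 1) (+ b / suc d))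
  (ℚᵘ.≃-trans (ℚᵘ.*-cong (toℚᵘ-/ a 0) (toℚᵘ-/ b d))
    (ℚᵘ.≃-trans product (ℚᵘ.≃-sym (toℚᵘ-/ (a * b) d)))))
  where
  product : frac a 0 ℚᵘ.* frac b d ≃ frac (a * b) d
  product = *≡* (cong₂ ℤ._*_ (sym (pos-* a b)) (cong (λ z → + suc z) (sym (ℕ.+-identityʳ d))))

/-+ : ∀ a b d .{{_ : NonZero d}} → (+ a / d) ℚ.+ (+ b / d) ≡ + (a + b) / d
/-+ a b (suc d) = toℚᵘ-injective (ℚᵘ.≃-trans (toℚᵘ-homo-+ (+ a / suc d) (+ b / suc d))
  (ℚᵘ.≃-trans (ℚᵘ.+-cong (toℚᵘ-/ a d) (toℚᵘ-/ b d))
    (ℚᵘ.≃-trans added (ℚᵘ.≃-sym (toℚᵘ-/ (a + b) d)))))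
  where
  common-denominator : ∀ x y s → (x ℤ.* s ℤ.+ y ℤ.* s) ℤ.* s ≡ (x ℤ.+ y) ℤ.* (s ℤ.* s)
  common-denominator = ℤ-Solver.solve-∀
  added : frac a d ℚᵘ.+ frac b d ≃ frac (a + b) d
  added = *≡* (trans (common-denominator (+ a) (+ b) (+ suc d))
                   (cong ((+ a ℤ.+ + b) ℤ.*_) (sym (pos-* (suc d) (suc d)))))

/-cancel : ∀ x d .{{_ : NonZero d}} → + (d * x) / d ≡ + x / 1
/-cancel x (suc d) = toℚᵘ-injective (ℚᵘ.≃-trans (toℚᵘ-/ (suc d * x) d)
  (ℚᵘ.≃-trans cancel (ℚᵘ.≃-sym (toℚᵘ-/ x 0))))
  where
  cancel : frac (suc d * x) d ≃ frac x 0
  cancel = *≡* (trans (sym (pos-* (suc d * x) 1))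
                 (trans (cong +_ (trans (ℕ.*-identityʳ _) (ℕ.*-comm (suc d) x))) (pos-* x (suc d))))

size⇔internal : ∀ n s → (size s ≡ 2 * n + 1) ⇔ (internal s ≡ n)
size⇔internal n s = mk⇔
  (λ |s|≡2n+1 → ℕ.*-cancelˡ-≡ (internal s) n 2
                  (ℕ.+-cancelʳ-≡ 1 (2 * internal s) (2 * n) (trans (sym (size≡2internal+1 s)) |s|≡2n+1)))
  (λ { refl → size≡2internal+1 s })

lookup-injective : ∀ {A : Set} {xs : List A} → Unique xs → ∀ {i j} → lookup xs i ≡ lookup xs j → i ≡ j
lookup-injective {xs = x ∷ xs} (x∉xs ∷ _) {zero} {zero} _ = refl
lookup-injective {xs = x ∷ xs} (x∉xs ∷ _) {zero} {suc j} x≡xⱼ = ⊥-elim (All.lookup x∉xs (∈-lookup j) x≡xⱼ)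
lookup-injective {xs = x ∷ xs} (x∉xs ∷ _) {suc i} {zero} xᵢ≡x = ⊥-elim (All.lookup x∉xs (∈-lookup i) (sym xᵢ≡x))
lookup-injective {xs = x ∷ xs} (_ ∷ unique) {suc i} {suc j} xᵢ≡xⱼ = cong suc (lookup-injective unique xᵢ≡xⱼ)

-- A duplicate-free list of exactly the trees with 2n+1 vertices has
-- catalan n entries: its positions enumerate TreesWith n.
trees-of-size : ∀ n (Ts : List Tree) → Unique Ts → (∀ s → (s ∈ Ts) ⇔ (size s ≡ 2 * n + 1)) →
  length Ts ≡ catalan n
trees-of-size n Ts unique members = count-unique ≈T-isEquivalence enumeration (catalan-count n)
  where
  internal≡n : ∀ {s} → s ∈ Ts → internal s ≡ n
  internal≡n s∈Ts = Equivalence.to (size⇔internal n _) (Equivalence.to (members _) s∈Ts)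
  enumeration : CountUpTo (TreesWith n) _≈T_ (length Ts)
  enumeration =
    (λ i → lookup Ts i , internal≡n (∈-lookup i)) ,
    (λ (s , internal-s≡n) → let s∈Ts = Equivalence.from (members s) (Equivalence.from (size⇔internal n s) internal-s≡n)
                             in index s∈Ts , sym (lookup-index s∈Ts)) ,
    (λ i j → lookup-injective unique)

-- For s in the class of r we have
-- H(r) #L(s) = H(s) #L(s) = (2n+1)! by pivot invariance and the hook length
-- formula, and the classes of the representatives partition Ts.
hook-weighted-class-sum : ∀ n (Ts : List Tree) → (∀ s → s ∈ Ts → size s ≡ 2 * n + 1) →
  (cnt : Tree → ℕ) → (∀ s → HasCount s (cnt s)) →
  (R : List Tree) → AllPairs (λ a b → ¬ (a ~ b)) R → (∀ s → s ∈ Ts → ∃ λ r → r ∈ R × (s ~ r)) →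
  (dec : ∀ s t → Dec (s ~ t)) →
  sumℕ (map (λ r → hookProd r * Tcls Ts cnt dec r) R) ≡ (2 * n + 1) ! * length Ts
hook-weighted-class-sum n Ts sizes cnt counts R distinct covers dec = begin
  sumℕ (map (λ r → hookProd r * Tcls Ts cnt dec r) R)
    ≡⟨ sum-cong R (λ r _ → class-sum (hookProd r) cnt K r Ts (λ s s∈Ts s~r → hook-in-class s∈Ts s~r)) ⟩
  sumℕ (map (λ r → K * length (classIn Ts r)) R)  ≡⟨ sum-*ˡ K _ R ⟩
  K * sumℕ (map (λ r → length (classIn Ts r)) R)  ≡⟨ cong (K *_) (sum-class-sizes Ts R distinct covers) ⟩
  K * length Ts ∎
  where
  open ClassCounting ~-isEquivalence dec
  K = (2 * n + 1) !
  hook-in-class : ∀ {s r} → s ∈ Ts → s ~ r → hookProd r * cnt s ≡ K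
  hook-in-class {s} {r} s∈Ts s~r = begin
    hookProd r * cnt s ≡⟨ cong (_* cnt s) (~-hookProd s~r) ⟨
    hookProd s * cnt s ≡⟨ hook-length-formula s (counts s) ⟩
    size s !           ≡⟨ cong _! (sizes s s∈Ts) ⟩
    K ∎

module _ {n : ℕ} where
  private instance
    4ⁿ≢0 : NonZero (2 ^ (2 * n))
    4ⁿ≢0 = ℕ.m^n≢0 2 (2 * n)

  fval≡fraction : ∀ Ts cnt dec Rs →
    fval n Ts cnt dec Rs ≡ + ((n + 1) * sumℕ (map (λ r → hookProd r * Tcls Ts cnt dec r) Rs)) / 2 ^ (2 * n)
  fval≡fraction Ts cnt dec [] = trans (sym (0/n≡0 (2 ^ (2 * n)))) (cong (λ x → + x / 2 ^ (2 * n)) (sym (ℕ.*-zeroʳ (n + 1))))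
  fval≡fraction Ts cnt dec (r ∷ Rs) = begin
    (+ H / 1) ℚ.* (+ ((n + 1) * T) / D) ℚ.+ fval n Ts cnt dec Rs
      ≡⟨ cong₂ ℚ._+_ (/-*ˡ H ((n + 1) * T) D) (fval≡fraction Ts cnt dec Rs) ⟩
    + (H * ((n + 1) * T)) / D ℚ.+ + ((n + 1) * S) / D
      ≡⟨ /-+ (H * ((n + 1) * T)) ((n + 1) * S) D ⟩
    + (H * ((n + 1) * T) + (n + 1) * S) / D
      ≡⟨ cong (λ x → + x / D) (factor-out H (n + 1) T S) ⟩
    + ((n + 1) * (H * T + S)) / D ∎
    where
    H = hookProd r
    T = Tcls Ts cnt dec r
    S = sumℕ (map (λ r → hookProd r * Tcls Ts cnt dec r) Rs)
    D = 2 ^ (2 * n)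
    factor-out : ∀ h a t s → h * (a * t) + a * s ≡ a * (h * t + s)
    factor-out = solve-∀

  fval≡ : ∀ Ts cnt dec Rs X →
    (n + 1) * sumℕ (map (λ r → hookProd r * Tcls Ts cnt dec r) Rs) ≡ 2 ^ (2 * n) * X →
    fval n Ts cnt dec Rs ≡ + X / 1
  fval≡ Ts cnt dec Rs X numerator≡ =
    trans (fval≡fraction Ts cnt dec Rs) (trans (cong (λ x → + x / 2 ^ (2 * n)) numerator≡) (/-cancel X (2 ^ (2 * n))))

theorem3p3 : (n : ℕ)
    → (Ts : List Tree) → Unique Ts → (∀ s → (s ∈ Ts) ⇔ (size s ≡ 2 * n + 1))
    → (cnt : Tree → ℕ) → (∀ s → HasCount s (cnt s))
    → (R : List Tree) → (∀ r → r ∈ R → r ∈ Ts) → AllPairs (λ a b → ¬ (a ~ b)) R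
    → (∀ s → s ∈ Ts → ∃ λ r → r ∈ R × (s ~ r))
    → (dec : ∀ s t → Dec (s ~ t))
    → (fval n Ts cnt dec R ≡ (+ (oddProd n * oddProd n * (2 * n + 1))) / 1)
      × (fval n Ts cnt dec R ≡ (+ (oddProd n * oddProd (suc n))) / 1)
theorem3p3 n Ts unique members cnt counts R _ distinct covers dec =
  trans f≡X (cong (λ x → + x / 1) (sym (ℕ.*-assoc (oddProd n) (oddProd n) (2 * n + 1)))) , f≡X
  where
  K = (2 * n + 1) !
  f≡X : fval n Ts cnt dec R ≡ + (oddProd n * oddProd (suc n)) / 1
  f≡X = fval≡ Ts cnt dec R _ (begin
    (n + 1) * sumℕ (map (λ r → hookProd r * Tcls Ts cnt dec r) R)
      ≡⟨ cong ((n + 1) *_) (hook-weighted-class-sum n Ts (λ s → Equivalence.to (members s)) cnt counts R distinct covers dec) ⟩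
    (n + 1) * (K * length Ts)     ≡⟨ cong (λ m → (n + 1) * (K * m)) (trees-of-size n Ts unique members) ⟩
    (n + 1) * (K * catalan n)     ≡⟨ cong ((n + 1) *_) (ℕ.*-comm K (catalan n)) ⟩
    (n + 1) * (catalan n * K)     ≡⟨ ℕ.*-assoc (n + 1) (catalan n) K ⟨
    (n + 1) * catalan n * K       ≡⟨ catalan-identity n ⟩
    2 ^ (2 * n) * (oddProd n * oddProd (suc n)) ∎)
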